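{- Let $G$ be a finite regular digraph in which every vertex has in-degree and out-degree equal to $k$, where $k\ge 9$. Then every pair of distinct vertices of $G$ is separable by a friendly partition.
   Context: Digraphs have no loops and no parallel arcs in the same direction. A friendly partition of $G=(V,E)$ is a partition $\{V_1,V_2\}$ of $V$ into two nonempty sets such that every vertex has at least one out-neighbor in its own part; a pair $u,v$ is separable if some friendly partition puts them in different parts. -}

module Defs where

open import Data.Nat using (ℕ; _≤_)
open import Data.Bool using (Bool; true; false; if_then_else_)
open import Data.Fin using (Fin)
open import Data.List using (List; map; allFin)
open import Data.Nat.ListAction using (sum)
open import Data.Product using (Σ; ∃; _×_; _,_)
open import Relation.Binary.PropositionalEquality using (_≡_; _≢_)

-- A finite digraph on vertex set Fin n: a Boolean arc relation with no loops.
-- (Being a relation, it has no parallel arcs in the same direction;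
--  arcs in both directions u→v and v→u are allowed.)
record Digraph (n : ℕ) : Set where
  field
    arc    : Fin n → Fin n → Bool
    noLoop : ∀ v → arc v v ≡ false
open Digraph public

countFin : (n : ℕ) → (Fin n → Bool) → ℕ
countFin n p = sum (map (λ w → if p w then 1 else 0) (allFin n))

outDeg : ∀ {n} → Digraph n → Fin n → ℕ
outDeg {n} G v = countFin n (λ w → arc G v w)

inDeg : ∀ {n} → Digraph n → Fin n → ℕ
inDeg {n} G v = countFin n (λ u → arc G u v)

Regular : ∀ {n} → Digraph n → ℕ → Set
Regular G k = ∀ v → outDeg G v ≡ k × inDeg G v ≡ k

-- A partition {V₁,V₂} of V is encoded by its indicator P : V → Bool
-- (V₁ = P⁻¹(true), V₂ = P⁻¹(false)).
Friendly : ∀ {n} → Digraph n → (Fin n → Bool) → Set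
Friendly {n} G P =
  (∃ λ (a : Fin n) → P a ≡ true) ×
  (∃ λ (b : Fin n) → P b ≡ false) ×
  (∀ v → ∃ λ (w : Fin n) → arc G v w ≡ true × P w ≡ P v)

Separable : ∀ {n} → Digraph n → Fin n → Fin n → Set
Separable {n} G u v = ∃ λ (P : Fin n → Bool) → Friendly G P × P u ≢ P v

-- Colour u true, v false and every other vertex by an independent fair coin (an assignment
-- ω : Fin n → Bool).  The colour classes separate u and v, and they are friendly unless some
-- vertex x is lonely, i.e. has no out-neighbour of its own colour.  Loneliness of x only reads
-- the free vertices of the closed out-neighbourhood N⁺[x], which has k + 1 vertices: a lonely x
-- determines the colours on N⁺[x] from its own, and a fixed vertex in N⁺[x] even determines the
-- colour of x.  Hence P(x lonely) ≤ w x · 2⁻ᵏ, where w x = 2 if u, v ∈ N⁺[x] and w x = 1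
-- otherwise.  Two such events share variables only if the neighbourhoods meet, which happens for
-- at most (k+1)² vertices, so the weights of the events sharing variables with a given one sum
-- to at most M = (k+1)² + (k+1), and 4M ≤ 2ᵏ once k ≥ 9.  These are the hypotheses of a weighted
-- Lovász Local Lemma, proved by counting assignments: P(E a | no event of S) ≤ w a / 2M follows
-- by induction on |S|, splitting S into the events sharing variables with E a (controlled by the
-- induction hypothesis and a union bound) and the others (independent of E a).

module Submission where

open import Data.Bool using (Bool; true; false; not; _∧_; _∨_; if_then_else_)
import Data.Bool.Properties as Bool
open import Data.Fin using (Fin; zero; suc; punchIn)
open import Data.Fin.Properties using (_≟_; punchInᵢ≢i)
open import Data.List using (tabulate)
open import Data.List.Properties using (map-tabulate)
open import Data.Nat hiding (_≟_)
import Data.Nat.ListAction as List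
open import Data.Nat.Induction using (<-wellFounded)
open import Data.Nat.Properties hiding (_≟_)
open import Data.Nat.Tactic.RingSolver using (solve-∀)
open import Algebra.Properties.Semiring.Sum +-*-semiring
  using (sum; sum-syntax; sum-cong-≗; sum-remove; sum-replicate-zero; ∑-distrib-+; ∑-comm; *-distribˡ-sum; *-distribʳ-sum)
open import Data.Product using (∃; _×_; _,_; proj₁; proj₂)
open import Data.Vec.Functional using (Vector; []; _∷_; foldr)
open import Function using (_∘_; mk⇔)
open import Induction.WellFounded using (WellFounded; module All)
import Relation.Binary.Construct.On as On
open import Relation.Binary.PropositionalEquality
open import Relation.Nullary using (Dec; does; yes; no; ¬_; contradiction)
open import Relation.Nullary.Decidable using (dec-true; dec-false; does-⇔)

open import Defs

-- Iverson bracket, spelled as in `countFin` so that the two counts agree by unfolding.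
⟦_⟧ : Bool → ℕ
⟦ b ⟧ = if b then 1 else 0

⟦⟧≤1 : ∀ b → ⟦ b ⟧ ≤ 1
⟦⟧≤1 true  = ≤-refl
⟦⟧≤1 false = z≤n

⟦∨⟧≤ : ∀ a b → ⟦ a ∨ b ⟧ ≤ ⟦ a ⟧ + ⟦ b ⟧
⟦∨⟧≤ true  b = s≤s z≤n
⟦∨⟧≤ false b = ≤-refl

⟦⟧-mono : ∀ {a b} → (a ≡ true → b ≡ true) → ⟦ a ⟧ ≤ ⟦ b ⟧
⟦⟧-mono {false} _   = z≤n
⟦⟧-mono {true}  a⇒b rewrite a⇒b refl = ≤-refl

⟦⟧-+ : ∀ a b → ⟦ a ⟧ + ⟦ b ⟧ ≡ ⟦ a ∧ b ⟧ + ⟦ a ∨ b ⟧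
⟦⟧-+ true  true  = refl
⟦⟧-+ true  false = refl
⟦⟧-+ false b     = refl

⟦∧⟧≡* : ∀ a b → ⟦ a ∧ b ⟧ ≡ ⟦ a ⟧ * ⟦ b ⟧
⟦∧⟧≡* true  b = sym (+-identityʳ ⟦ b ⟧)
⟦∧⟧≡* false b = refl

⟦⟧-pos : ∀ {b} → 0 < ⟦ b ⟧ → b ≡ true
⟦⟧-pos {true} _ = refl

∧≡false⇒ˡ≡false : ∀ {a b} → (a ∧ b) ≡ false → b ≡ true → a ≡ false
∧≡false⇒ˡ≡false {a} a∧b≡false refl = trans (sym (Bool.∧-identityʳ a)) a∧b≡false

∧≡false⇒ʳ≡false : ∀ {a b} → (a ∧ b) ≡ false → a ≡ true → b ≡ false
∧≡false⇒ʳ≡false a∧b≡false refl = a∧b≡false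

∧-not≡false⇒≡true : ∀ {a b} → a ≡ true → (a ∧ not b) ≡ false → b ≡ true
∧-not≡false⇒≡true refl = Bool.not-injective

does-true : ∀ {A : Set} (a? : Dec A) → does a? ≡ true → A
does-true (yes a) _ = a

does-false : ∀ {A : Set} (a? : Dec A) → does a? ≡ false → ¬ A
does-false (no ¬a) _ = ¬a

_==_ : ∀ {n} → Fin n → Fin n → Bool
i == j = does (i ≟ j)

sum-mono-≤ : ∀ {n} {f g : Vector ℕ n} → (∀ i → f i ≤ g i) → sum f ≤ sum g
sum-mono-≤ {zero}  f≤g = z≤n
sum-mono-≤ {suc n} f≤g = +-mono-≤ (f≤g zero) (sum-mono-≤ (f≤g ∘ suc))

≤-sum : ∀ {n} (f : Vector ℕ n) i → f i ≤ sum f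
≤-sum {suc n} f i = subst (f i ≤_) (sym (sum-remove {i = i} f)) (m≤m+n (f i) _)

sum-mono-< : ∀ {n} {f g : Vector ℕ n} → (∀ i → f i ≤ g i) → ∀ j → f j < g j → sum f < sum g
sum-mono-< {suc n} {f} {g} f≤g j f<g = subst₂ _<_ (sym (sum-remove {i = j} f)) (sym (sum-remove {i = j} g))
  (+-mono-<-≤ f<g (sum-mono-≤ (f≤g ∘ punchIn j)))

∑-select : ∀ {n} (f : Vector ℕ n) j → ∑[ i < n ] (⟦ i == j ⟧ * f i) ≡ f j
∑-select {suc n} f j = begin
  ∑[ i < suc n ] (⟦ i == j ⟧ * f i)
    ≡⟨ sum-remove {i = j} (λ i → ⟦ i == j ⟧ * f i) ⟩
  ⟦ j == j ⟧ * f j + ∑[ i < n ] (⟦ punchIn j i == j ⟧ * f (punchIn j i))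
    ≡⟨ cong₂ _+_ (cong (λ b → ⟦ b ⟧ * f j) (dec-true (j ≟ j) refl))
                 (sum-cong-≗ (λ i → cong (λ b → ⟦ b ⟧ * f (punchIn j i)) (dec-false (punchIn j i ≟ j) (punchInᵢ≢i j i)))) ⟩
  1 * f j + ∑[ i < n ] 0
    ≡⟨ cong₂ _+_ (*-identityˡ (f j)) (sum-replicate-zero n) ⟩
  f j + 0
    ≡⟨ +-identityʳ (f j) ⟩
  f j ∎
  where open ≡-Reasoning

count : ∀ {n} → (Fin n → Bool) → ℕ
count {n} p = ∑[ i < n ] ⟦ p i ⟧

count-≟-∧ : ∀ {n} (j : Fin n) (p : Fin n → Bool) → count (λ i → i == j ∧ p i) ≡ ⟦ p j ⟧
count-≟-∧ j p = trans (sum-cong-≗ (λ i → ⟦∧⟧≡* (i == j) (p i))) (∑-select (λ i → ⟦ p i ⟧) j)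

count-≟ : ∀ {n} (j : Fin n) → count (λ i → i == j) ≡ 1
count-≟ j = trans (sum-cong-≗ (λ i → sym (*-identityʳ ⟦ i == j ⟧))) (∑-select (λ _ → 1) j)

countFin≡count : ∀ n (p : Fin n → Bool) → countFin n p ≡ count p
countFin≡count n p = trans (cong List.sum (map-tabulate (λ i → i) (λ i → ⟦ p i ⟧))) (sum-tabulate (λ i → ⟦ p i ⟧))
  where
  sum-tabulate : ∀ {m} (f : Vector ℕ m) → List.sum (tabulate f) ≡ sum f
  sum-tabulate {zero}  f = refl
  sum-tabulate {suc m} f = cong (f zero +_) (sum-tabulate (f ∘ suc))

any : ∀ {n} → (Fin n → Bool) → Bool
any = foldr _∨_ false

any-intro : ∀ {n} (p : Fin n → Bool) i → p i ≡ true → any p ≡ true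
any-intro p zero    pi≡true rewrite pi≡true = refl
any-intro p (suc i) pi≡true with p zero
... | true  = refl
... | false = any-intro (p ∘ suc) i pi≡true

any-elim : ∀ {n} (p : Fin n → Bool) → any p ≡ true → ∃ λ i → p i ≡ true
any-elim {suc n} p any≡true with p zero in p0
... | true  = zero , p0
... | false with any-elim (p ∘ suc) any≡true
...   | i , pi≡true = suc i , pi≡true

any-false : ∀ {n} (p : Fin n → Bool) → any p ≡ false → ∀ i → p i ≡ false
any-false p any≡false i with p i in pi
... | false = refl
... | true  = trans (sym (any-intro p i pi)) any≡false

any-cong : ∀ {n} {p q : Fin n → Bool} → (∀ i → p i ≡ q i) → any p ≡ any q
any-cong {zero}  p≗q = refl
any-cong {suc n} p≗q = cong₂ _∨_ (p≗q zero) (any-cong (p≗q ∘ suc))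

any-none : ∀ {n} (p : Fin n → Bool) → (∀ i → p i ≡ false) → any p ≡ false
any-none {zero}  p none = refl
any-none {suc n} p none rewrite none zero = any-none (p ∘ suc) (none ∘ suc)

⟦any⟧≤count : ∀ {n} (p : Fin n → Bool) → ⟦ any p ⟧ ≤ count p
⟦any⟧≤count {zero}  p = z≤n
⟦any⟧≤count {suc n} p = ≤-trans (⟦∨⟧≤ (p zero) (any (p ∘ suc))) (+-monoʳ-≤ ⟦ p zero ⟧ (⟦any⟧≤count (p ∘ suc)))

count-∧-< : ∀ {n} (p q : Fin n → Bool) j → p j ≡ true → q j ≡ false → count (λ i → p i ∧ q i) < count p
count-∧-< p q j pj qj =
  sum-mono-< (λ i → ⟦∧⟧≤ˡ (p i) (q i)) j (subst₂ (λ a b → ⟦ a ∧ b ⟧ < ⟦ a ⟧) (sym pj) (sym qj) ≤-refl)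
  where
  ⟦∧⟧≤ˡ : ∀ a b → ⟦ a ∧ b ⟧ ≤ ⟦ a ⟧
  ⟦∧⟧≤ˡ true  b = ⟦⟧≤1 b
  ⟦∧⟧≤ˡ false b = z≤n

-- Sums over all assignments of n Boolean variables

Assignment : ℕ → Set
Assignment n = Fin n → Bool

∑Ω : ∀ {n} → (Assignment n → ℕ) → ℕ
∑Ω {zero}  f = f []
∑Ω {suc n} f = ∑Ω (f ∘ (false ∷_)) + ∑Ω (f ∘ (true ∷_))

#_ : ∀ {n} → (Assignment n → Bool) → ℕ
# P = ∑Ω (λ ω → ⟦ P ω ⟧)

∑Ω-cong : ∀ {n} {f g : Assignment n → ℕ} → (∀ ω → f ω ≡ g ω) → ∑Ω f ≡ ∑Ω g
∑Ω-cong {zero}  f≗g = f≗g []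
∑Ω-cong {suc n} f≗g = cong₂ _+_ (∑Ω-cong (f≗g ∘ (false ∷_))) (∑Ω-cong (f≗g ∘ (true ∷_)))

∑Ω-mono-≤ : ∀ {n} {f g : Assignment n → ℕ} → (∀ ω → f ω ≤ g ω) → ∑Ω f ≤ ∑Ω g
∑Ω-mono-≤ {zero}  f≤g = f≤g []
∑Ω-mono-≤ {suc n} f≤g = +-mono-≤ (∑Ω-mono-≤ (f≤g ∘ (false ∷_))) (∑Ω-mono-≤ (f≤g ∘ (true ∷_)))

∑Ω-distrib-+ : ∀ {n} (f g : Assignment n → ℕ) → ∑Ω (λ ω → f ω + g ω) ≡ ∑Ω f + ∑Ω g
∑Ω-distrib-+ {zero}  f g = refl
∑Ω-distrib-+ {suc n} f g = begin
  ∑Ω (λ ω → f₀ ω + g₀ ω) + ∑Ω (λ ω → f₁ ω + g₁ ω)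
    ≡⟨ cong₂ _+_ (∑Ω-distrib-+ f₀ g₀) (∑Ω-distrib-+ f₁ g₁) ⟩
  (∑Ω f₀ + ∑Ω g₀) + (∑Ω f₁ + ∑Ω g₁)
    ≡⟨ +-exchange (∑Ω f₀) (∑Ω g₀) (∑Ω f₁) (∑Ω g₁) ⟩
  (∑Ω f₀ + ∑Ω f₁) + (∑Ω g₀ + ∑Ω g₁) ∎
  where
  open ≡-Reasoning
  f₀ = f ∘ (false ∷_)
  f₁ = f ∘ (true ∷_)
  g₀ = g ∘ (false ∷_)
  g₁ = g ∘ (true ∷_)
  +-exchange : ∀ a b c d → (a + b) + (c + d) ≡ (a + c) + (b + d)
  +-exchange = solve-∀

*-distribˡ-∑Ω : ∀ {n} c (f : Assignment n → ℕ) → ∑Ω (λ ω → c * f ω) ≡ c * ∑Ω f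
*-distribˡ-∑Ω {zero}  c f = refl
*-distribˡ-∑Ω {suc n} c f =
  trans (cong₂ _+_ (*-distribˡ-∑Ω c (f ∘ (false ∷_))) (*-distribˡ-∑Ω c (f ∘ (true ∷_)))) (sym (*-distribˡ-+ c _ _))

∑Ω-const : ∀ {n} c → ∑Ω {n} (λ _ → c) ≡ 2 ^ n * c
∑Ω-const {zero}  c = sym (+-identityʳ c)
∑Ω-const {suc n} c = trans (cong₂ _+_ (∑Ω-const {n} c) (∑Ω-const {n} c)) (double-* (2 ^ n) c)
  where
  double-* : ∀ a c → a * c + a * c ≡ (2 * a) * c
  double-* = solve-∀

∑Ω-zero : ∀ {n} → ∑Ω {n} (λ _ → 0) ≡ 0
∑Ω-zero {n} = trans (∑Ω-const {n} 0) (*-zeroʳ (2 ^ n))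

∑Ω-∑-comm : ∀ {n m} (f : Assignment n → Fin m → ℕ) → ∑Ω (λ ω → ∑[ b < m ] f ω b) ≡ ∑[ b < m ] ∑Ω (λ ω → f ω b)
∑Ω-∑-comm {n} {zero}  f = ∑Ω-zero {n}
∑Ω-∑-comm {n} {suc m} f =
  trans (∑Ω-distrib-+ (λ ω → f ω zero) _) (cong (∑Ω (λ ω → f ω zero) +_) (∑Ω-∑-comm (λ ω → f ω ∘ suc)))

∑Ω-pos⇒∃ : ∀ {n} (f : Assignment n → ℕ) → 0 < ∑Ω f → ∃ λ ω → 0 < f ω
∑Ω-pos⇒∃ {zero}  f pos = [] , pos
∑Ω-pos⇒∃ {suc n} f pos with ∑Ω (f ∘ (false ∷_)) in eq
... | zero  = let ω , fω>0 = ∑Ω-pos⇒∃ (f ∘ (true ∷_)) pos in true ∷ ω , fω>0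
... | suc _ = let ω , fω>0 = ∑Ω-pos⇒∃ (f ∘ (false ∷_)) (subst (0 <_) (sym eq) (s≤s z≤n)) in false ∷ ω , fω>0

DependsOn : ∀ {n} {A : Set} → (Fin n → Bool) → (Assignment n → A) → Set
DependsOn {n} X f = ∀ ω ω′ → (∀ i → X i ≡ true → ω i ≡ ω′ i) → f ω ≡ f ω′

dependsOn-⊆ : ∀ {n} {A : Set} {X Y : Fin n → Bool} {f : Assignment n → A} →
  (∀ i → X i ≡ true → Y i ≡ true) → DependsOn X f → DependsOn Y f
dependsOn-⊆ X⊆Y f-dep ω ω′ agree = f-dep ω ω′ (λ i Xi → agree i (X⊆Y i Xi))

dependsOn-tail : ∀ {n} {A : Set} {X : Fin (suc n) → Bool} {f : Assignment (suc n) → A} b →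
  DependsOn X f → DependsOn (X ∘ suc) (f ∘ (b ∷_))
dependsOn-tail b f-dep ω ω′ agree = f-dep _ _ λ { zero _ → refl ; (suc i) Xi → agree i Xi }

dependsOn-head : ∀ {n} {A : Set} {X : Fin (suc n) → Bool} {f : Assignment (suc n) → A} →
  X zero ≡ false → DependsOn X f → ∀ ω → f (true ∷ ω) ≡ f (false ∷ ω)
dependsOn-head X₀ f-dep ω = f-dep _ _ λ { zero X₀≡true → contradiction (trans (sym X₀) X₀≡true) (λ ()) ; (suc i) _ → refl }

dependsOn-∘ : ∀ {n} {A B : Set} {X : Fin n → Bool} {f : Assignment n → A} (h : A → B) → DependsOn X f → DependsOn X (h ∘ f)
dependsOn-∘ h f-dep ω ω′ agree = cong h (f-dep ω ω′ agree)

ProductFormula : ℕ → Set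
ProductFormula n = ∀ (X : Fin n → Bool) {f g : Assignment n → ℕ} → DependsOn X f → DependsOn (not ∘ X) g →
  ∑Ω (λ ω → f ω * g ω) * 2 ^ n ≡ ∑Ω f * ∑Ω g

-- Splitting off a variable that f ignores: g may depend on it, so it is summed out.
product-step : ∀ {n} → ProductFormula n → ∀ (X : Fin (suc n) → Bool) {f g} → X zero ≡ false →
  DependsOn X f → DependsOn (not ∘ X) g → ∑Ω (λ ω → f ω * g ω) * 2 ^ suc n ≡ ∑Ω f * ∑Ω g
product-step {n} IH X {f} {g} X₀ f-dep g-dep = begin
  (∑Ω (λ ω → f₀ ω * g₀ ω) + ∑Ω (λ ω → f₁ ω * g₁ ω)) * (2 * 2 ^ n)
    ≡⟨ cong (λ s → (∑Ω (λ ω → f₀ ω * g₀ ω) + s) * (2 * 2 ^ n)) (∑Ω-cong (λ ω → cong (_* g₁ ω) (f₁≗f₀ ω))) ⟩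
  (∑Ω (λ ω → f₀ ω * g₀ ω) + ∑Ω (λ ω → f₀ ω * g₁ ω)) * (2 * 2 ^ n)
    ≡⟨ cong (_* (2 * 2 ^ n)) (sym (trans (∑Ω-cong (λ ω → *-distribˡ-+ (f₀ ω) (g₀ ω) (g₁ ω)))
                                         (∑Ω-distrib-+ (λ ω → f₀ ω * g₀ ω) (λ ω → f₀ ω * g₁ ω)))) ⟩
  ∑Ω (λ ω → f₀ ω * g′ ω) * (2 * 2 ^ n)
    ≡⟨ *-rotate (∑Ω (λ ω → f₀ ω * g′ ω)) (2 ^ n) ⟩
  2 * (∑Ω (λ ω → f₀ ω * g′ ω) * 2 ^ n)
    ≡⟨ cong (2 *_) (IH (X ∘ suc) (dependsOn-tail false f-dep) g′-dep) ⟩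
  2 * (∑Ω f₀ * ∑Ω g′)
    ≡⟨ cong (λ s → 2 * (∑Ω f₀ * s)) (∑Ω-distrib-+ g₀ g₁) ⟩
  2 * (∑Ω f₀ * (∑Ω g₀ + ∑Ω g₁))
    ≡⟨ sym (*-assoc 2 (∑Ω f₀) _) ⟩
  (∑Ω f₀ + (∑Ω f₀ + 0)) * (∑Ω g₀ + ∑Ω g₁)
    ≡⟨ cong (λ s → (∑Ω f₀ + s) * (∑Ω g₀ + ∑Ω g₁)) (trans (+-identityʳ _) (sym (∑Ω-cong f₁≗f₀))) ⟩
  (∑Ω f₀ + ∑Ω f₁) * (∑Ω g₀ + ∑Ω g₁) ∎
  where
  open ≡-Reasoning
  f₀ = f ∘ (false ∷_)
  f₁ = f ∘ (true ∷_)
  g₀ = g ∘ (false ∷_)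
  g₁ = g ∘ (true ∷_)
  g′ : Assignment n → ℕ
  g′ ω = g₀ ω + g₁ ω
  f₁≗f₀ : ∀ ω → f₁ ω ≡ f₀ ω
  f₁≗f₀ = dependsOn-head X₀ f-dep
  g′-dep : DependsOn (not ∘ X ∘ suc) g′
  g′-dep ω ω′ agree = cong₂ _+_ (dependsOn-tail false g-dep ω ω′ agree) (dependsOn-tail true g-dep ω ω′ agree)
  *-rotate : ∀ a b → a * (2 * b) ≡ 2 * (a * b)
  *-rotate = solve-∀

∑Ω-product : ∀ {n} → ProductFormula n
∑Ω-product {zero}  X {f} {g} _ _ = *-identityʳ (f [] * g [])
∑Ω-product {suc n} X {f} {g} f-dep g-dep with X zero in X₀
... | false = product-step ∑Ω-product X X₀ f-dep g-dep
... | true  = begin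
  ∑Ω (λ ω → f ω * g ω) * 2 ^ suc n ≡⟨ cong (_* 2 ^ suc n) (∑Ω-cong (λ ω → *-comm (f ω) (g ω))) ⟩
  ∑Ω (λ ω → g ω * f ω) * 2 ^ suc n ≡⟨ product-step ∑Ω-product (not ∘ X) (cong not X₀) g-dep f-dep′ ⟩
  ∑Ω g * ∑Ω f                      ≡⟨ *-comm (∑Ω g) (∑Ω f) ⟩
  ∑Ω f * ∑Ω g                      ∎
  where
  open ≡-Reasoning
  f-dep′ : DependsOn (not ∘ not ∘ X) f
  f-dep′ = dependsOn-⊆ (λ i Xi → trans (Bool.not-involutive (X i)) Xi) f-dep

agreesOn : ∀ {n} → (Fin n → Bool) → Assignment n → Assignment n → Bool
agreesOn R t ω = not (any (λ i → R i ∧ not (does (ω i Bool.≟ t i))))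

agreesOn-intro : ∀ {n} {R : Fin n → Bool} {t ω : Assignment n} → (∀ i → R i ≡ true → ω i ≡ t i) → agreesOn R t ω ≡ true
agreesOn-intro {R = R} {t} {ω} agree = cong not (any-none _ mismatch)
  where
  mismatch : ∀ i → (R i ∧ not (does (ω i Bool.≟ t i))) ≡ false
  mismatch i with R i in Ri
  ... | false = refl
  ... | true  = cong not (dec-true (ω i Bool.≟ t i) (agree i Ri))

#agreesOn : ∀ {n} (R : Fin n → Bool) (t : Assignment n) → # agreesOn R t * 2 ^ count R ≡ 2 ^ n
#agreesOn {zero}  R t = refl
#agreesOn {suc n} R t with R zero | t zero | #agreesOn (R ∘ suc) (t ∘ suc)
... | false | _     | IH = trans (*-distribʳ-+ (2 ^ c) a a) (cong₂ _+_ IH (trans IH (sym (+-identityʳ (2 ^ n)))))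
  where
  a = # agreesOn (R ∘ suc) (t ∘ suc)
  c = count (R ∘ suc)
... | true  | true  | IH = trans (cong (λ z → (z + a) * (2 * 2 ^ c)) (∑Ω-zero {n})) (trans (*-rotate a (2 ^ c)) (cong (2 *_) IH))
  where
  a = # agreesOn (R ∘ suc) (t ∘ suc)
  c = count (R ∘ suc)
  *-rotate : ∀ a c → (0 + a) * (2 * c) ≡ 2 * (a * c)
  *-rotate = solve-∀
... | true  | false | IH = trans (cong (λ z → (a + z) * (2 * 2 ^ c)) (∑Ω-zero {n})) (trans (*-rotate a (2 ^ c)) (cong (2 *_) IH))
  where
  a = # agreesOn (R ∘ suc) (t ∘ suc)
  c = count (R ∘ suc)
  *-rotate : ∀ a c → (a + 0) * (2 * c) ≡ 2 * (a * c)
  *-rotate = solve-∀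

#≤-agreeing : ∀ {n} {P : Assignment n → Bool} (R : Fin n → Bool) (t : Assignment n) →
  (∀ ω → P ω ≡ true → agreesOn R t ω ≡ true) → # P * 2 ^ count R ≤ 2 ^ n
#≤-agreeing R t P⊆agree =
  ≤-trans (*-monoˡ-≤ (2 ^ count R) (∑Ω-mono-≤ (λ ω → ⟦⟧-mono (P⊆agree ω)))) (≤-reflexive (#agreesOn R t))

-- A weighted Lovász Local Lemma

meets : ∀ {n} → (Fin n → Bool) → (Fin n → Bool) → Bool
meets A B = any (λ i → A i ∧ B i)

count-wellFounded : ∀ {m} → WellFounded (λ (S T : Fin m → Bool) → count S < count T)
count-wellFounded = On.wellFounded count <-wellFounded

module LocalLemma {m n : ℕ}
  (E : Fin m → Assignment n → Bool)
  (X : Fin m → Fin n → Bool)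
  (E-dependsOn-X : ∀ a → DependsOn (X a) (E a))
  (w : Fin m → ℕ) (M : ℕ)
  (neighbourhood-weight : ∀ a → ∑[ b < m ] (⟦ meets (X a) (X b) ⟧ * w b) ≤ M)
  (event-bound : ∀ a → 4 * M * # E a ≤ w a * 2 ^ n)
  (weight<2M : ∀ a → w a < 2 * M)
  where

  avoids : (Fin m → Bool) → Assignment n → Bool
  avoids S ω = not (any (λ b → S b ∧ E b ω))

  #avoid : (Fin m → Bool) → ℕ
  #avoid S = # avoids S

  #avoid∧ : (Fin m → Bool) → Fin m → ℕ
  #avoid∧ S a = ∑Ω (λ ω → ⟦ avoids S ω ⟧ * ⟦ E a ω ⟧)

  avoids-antitone : ∀ {S T : Fin m → Bool} → (∀ b → T b ≡ true → S b ≡ true) →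
    ∀ ω → ⟦ avoids S ω ⟧ ≤ ⟦ avoids T ω ⟧
  avoids-antitone {S} {T} T⊆S ω with any (λ b → S b ∧ E b ω) in hitS
  ... | true  = z≤n
  ... | false = ≤-reflexive (cong (⟦_⟧ ∘ not) (sym (any-none _ missT)))
    where
    missT : ∀ b → (T b ∧ E b ω) ≡ false
    missT b with T b in Tb
    ... | false = refl
    ... | true  = subst (λ s → (s ∧ E b ω) ≡ false) (T⊆S b Tb) (any-false _ hitS b)

  union-bound-at : ∀ {S T R : Fin m → Bool} → (∀ b → S b ≡ true → T b ≡ false → R b ≡ true) → ∀ ω →
    ⟦ avoids T ω ⟧ ≤ ⟦ avoids S ω ⟧ + ∑[ b < m ] (⟦ R b ⟧ * (⟦ avoids T ω ⟧ * ⟦ E b ω ⟧))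
  union-bound-at {S} {T} {R} S∖T⊆R ω
    with any (λ b → S b ∧ E b ω) in hitS | any (λ b → T b ∧ E b ω) in hitT
  ... | false | hitsT = ≤-trans (⟦⟧≤1 (not hitsT)) (m≤m+n 1 _)
  ... | true  | true  = z≤n
  ... | true  | false with any-elim _ hitS
  ...   | b , SbEb = ≤-trans (≤-reflexive (sym term≡1)) (≤-sum (λ b → ⟦ R b ⟧ * (1 * ⟦ E b ω ⟧)) b)
    where
    Eb : E b ω ≡ true
    Eb = Bool.∧-conicalʳ (S b) (E b ω) SbEb
    Tb : T b ≡ false
    Tb = ∧≡false⇒ˡ≡false (any-false _ hitT b) Eb
    term≡1 : ⟦ R b ⟧ * (1 * ⟦ E b ω ⟧) ≡ 1
    term≡1 rewrite S∖T⊆R b (Bool.∧-conicalˡ (S b) (E b ω) SbEb) Tb | Eb = refl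

  union-bound : ∀ {S T R : Fin m → Bool} → (∀ b → S b ≡ true → T b ≡ false → R b ≡ true) →
    #avoid T ≤ #avoid S + ∑[ b < m ] (⟦ R b ⟧ * #avoid∧ T b)
  union-bound {S} {T} {R} S∖T⊆R = begin
    #avoid T
      ≤⟨ ∑Ω-mono-≤ (union-bound-at S∖T⊆R) ⟩
    ∑Ω (λ ω → ⟦ avoids S ω ⟧ + ∑[ b < m ] (⟦ R b ⟧ * (⟦ avoids T ω ⟧ * ⟦ E b ω ⟧)))
      ≡⟨ ∑Ω-distrib-+ (λ ω → ⟦ avoids S ω ⟧) (λ ω → ∑[ b < m ] (⟦ R b ⟧ * (⟦ avoids T ω ⟧ * ⟦ E b ω ⟧))) ⟩
    #avoid S + ∑Ω (λ ω → ∑[ b < m ] (⟦ R b ⟧ * (⟦ avoids T ω ⟧ * ⟦ E b ω ⟧)))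
      ≡⟨ cong (#avoid S +_) (∑Ω-∑-comm (λ ω b → ⟦ R b ⟧ * (⟦ avoids T ω ⟧ * ⟦ E b ω ⟧))) ⟩
    #avoid S + ∑[ b < m ] ∑Ω (λ ω → ⟦ R b ⟧ * (⟦ avoids T ω ⟧ * ⟦ E b ω ⟧))
      ≡⟨ cong (#avoid S +_) (sum-cong-≗ (λ b → *-distribˡ-∑Ω ⟦ R b ⟧ (λ ω → ⟦ avoids T ω ⟧ * ⟦ E b ω ⟧))) ⟩
    #avoid S + ∑[ b < m ] (⟦ R b ⟧ * #avoid∧ T b) ∎
    where open ≤-Reasoning

  avoids-dependsOn : ∀ {S : Fin m → Bool} {Y : Fin n → Bool} →
    (∀ b → S b ≡ true → ∀ i → X b i ≡ true → Y i ≡ true) → DependsOn Y (avoids S)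
  avoids-dependsOn {S} {Y} S⊆Y ω ω′ agree = cong not (any-cong same)
    where
    same : ∀ b → (S b ∧ E b ω) ≡ (S b ∧ E b ω′)
    same b with S b in Sb
    ... | false = refl
    ... | true  = dependsOn-⊆ (S⊆Y b Sb) (E-dependsOn-X b) ω ω′ agree

  Bound : (Fin m → Bool) → Set
  Bound S = ∀ a → 2 * M * #avoid∧ S a ≤ w a * #avoid S

  module Step (S : Fin m → Bool) (IH : ∀ {T} → count T < count S → Bound T) (a : Fin m) where

    near far : Fin m → Bool
    near b = S b ∧ meets (X a) (X b)
    far  b = S b ∧ not (meets (X a) (X b))

    far⊆S : ∀ b → far b ≡ true → S b ≡ true
    far⊆S b = Bool.∧-conicalˡ (S b) _

    far-independent : DependsOn (not ∘ X a) (avoids far)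
    far-independent = avoids-dependsOn λ b far-b i Xbi →
      cong not (∧≡false⇒ˡ≡false (any-false _ (Bool.not-injective (Bool.∧-conicalʳ (S b) _ far-b)) i) Xbi)

    far-event : 4 * M * #avoid∧ far a ≤ w a * #avoid far
    far-event = *-cancelʳ-≤ _ _ (2 ^ n) {{>-nonZero (m^n>0 2 n)}} (begin
      4 * M * #avoid∧ far a * 2 ^ n        ≡⟨ *-assoc (4 * M) (#avoid∧ far a) (2 ^ n) ⟩
      4 * M * (#avoid∧ far a * 2 ^ n)      ≡⟨ cong (λ s → 4 * M * (s * 2 ^ n)) (∑Ω-cong (λ ω → *-comm ⟦ avoids far ω ⟧ ⟦ E a ω ⟧)) ⟩
      4 * M * (∑Ω (λ ω → ⟦ E a ω ⟧ * ⟦ avoids far ω ⟧) * 2 ^ n)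
        ≡⟨ cong (4 * M *_) (∑Ω-product (X a) (dependsOn-∘ ⟦_⟧ (E-dependsOn-X a)) (dependsOn-∘ ⟦_⟧ far-independent)) ⟩
      4 * M * (# E a * #avoid far)         ≡⟨ *-assoc (4 * M) (# E a) (#avoid far) ⟨
      4 * M * # E a * #avoid far           ≤⟨ *-monoˡ-≤ (#avoid far) (event-bound a) ⟩
      w a * 2 ^ n * #avoid far             ≡⟨ *-swapʳ (w a) (2 ^ n) (#avoid far) ⟩
      w a * #avoid far * 2 ^ n             ∎)
      where
      open ≤-Reasoning
      *-swapʳ : ∀ x y z → x * y * z ≡ x * z * y
      *-swapʳ = solve-∀

    near-event : ∀ b → 2 * M * (⟦ near b ⟧ * #avoid∧ far b) ≤ ⟦ meets (X a) (X b) ⟧ * w b * #avoid far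
    near-event b with S b in Sb | meets (X a) (X b) in meets-ab
    ... | false | _    = ≤-trans (≤-reflexive (*-zeroʳ (2 * M))) z≤n
    ... | true  | false = ≤-trans (≤-reflexive (*-zeroʳ (2 * M))) z≤n
    ... | true  | true  = begin
      2 * M * (1 * #avoid∧ far b)  ≡⟨ cong (2 * M *_) (*-identityˡ (#avoid∧ far b)) ⟩
      2 * M * #avoid∧ far b        ≤⟨ IH (count-∧-< S _ b Sb (cong not meets-ab)) b ⟩
      w b * #avoid far             ≡⟨ cong (_* #avoid far) (*-identityˡ (w b)) ⟨
      1 * w b * #avoid far         ∎
      where open ≤-Reasoning

    near-events : 2 * M * ∑[ b < m ] (⟦ near b ⟧ * #avoid∧ far b) ≤ M * #avoid far
    near-events = begin
      2 * M * ∑[ b < m ] (⟦ near b ⟧ * #avoid∧ far b)         ≡⟨ *-distribˡ-sum (2 * M) (λ b → ⟦ near b ⟧ * #avoid∧ far b) ⟩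
      ∑[ b < m ] (2 * M * (⟦ near b ⟧ * #avoid∧ far b))       ≤⟨ sum-mono-≤ near-event ⟩
      ∑[ b < m ] (⟦ meets (X a) (X b) ⟧ * w b * #avoid far)   ≡⟨ *-distribʳ-sum (#avoid far) (λ b → ⟦ meets (X a) (X b) ⟧ * w b) ⟨
      ∑[ b < m ] (⟦ meets (X a) (X b) ⟧ * w b) * #avoid far   ≤⟨ *-monoˡ-≤ (#avoid far) (neighbourhood-weight a) ⟩
      M * #avoid far                                          ∎
      where open ≤-Reasoning

    M>0 : 0 < M
    M>0 = *-cancelˡ-< 2 0 M (m<n⇒0<n (weight<2M a))

    #avoid-far≤2* : #avoid far ≤ 2 * #avoid S
    #avoid-far≤2* = *-cancelˡ-≤ M {{>-nonZero M>0}} (subst (M * #avoid far ≤_) (*-comm-2 M (#avoid S))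
      (+-cancelʳ-≤ (M * #avoid far) (M * #avoid far) (2 * M * #avoid S) (begin
        M * #avoid far + M * #avoid far         ≡⟨ double M (#avoid far) ⟩
        2 * M * #avoid far                      ≤⟨ *-monoʳ-≤ (2 * M) (union-bound near-covers) ⟩
        2 * M * (#avoid S + ∑[ b < m ] (⟦ near b ⟧ * #avoid∧ far b))
          ≡⟨ *-distribˡ-+ (2 * M) (#avoid S) _ ⟩
        2 * M * #avoid S + 2 * M * ∑[ b < m ] (⟦ near b ⟧ * #avoid∧ far b)
          ≤⟨ +-monoʳ-≤ (2 * M * #avoid S) near-events ⟩
        2 * M * #avoid S + M * #avoid far       ∎)))
      where
      open ≤-Reasoning
      near-covers : ∀ b → S b ≡ true → far b ≡ false → near b ≡ true
      near-covers b Sb far-b = cong₂ _∧_ Sb (∧-not≡false⇒≡true Sb far-b)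
      double : ∀ x y → x * y + x * y ≡ 2 * x * y
      double = solve-∀
      *-comm-2 : ∀ x y → 2 * x * y ≡ x * (2 * y)
      *-comm-2 = solve-∀

    bound : 2 * M * #avoid∧ S a ≤ w a * #avoid S
    bound = *-cancelʳ-≤ _ _ 2 (begin
      2 * M * #avoid∧ S a * 2     ≡⟨ *-rotate M (#avoid∧ S a) ⟩
      4 * M * #avoid∧ S a         ≤⟨ *-monoʳ-≤ (4 * M) (∑Ω-mono-≤ (λ ω → *-monoˡ-≤ ⟦ E a ω ⟧ (avoids-antitone far⊆S ω))) ⟩
      4 * M * #avoid∧ far a       ≤⟨ far-event ⟩
      w a * #avoid far            ≤⟨ *-monoʳ-≤ (w a) #avoid-far≤2* ⟩
      w a * (2 * #avoid S)        ≡⟨ *-swap (w a) (#avoid S) ⟩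
      w a * #avoid S * 2          ∎)
      where
      open ≤-Reasoning
      *-rotate : ∀ x y → 2 * x * y * 2 ≡ 4 * x * y
      *-rotate = solve-∀
      *-swap : ∀ x y → x * (2 * y) ≡ x * y * 2
      *-swap = solve-∀

  bound : ∀ S → Bound S
  bound = All.wfRec count-wellFounded _ Bound (λ S IH a → Step.bound S IH a)

  #avoid-pos : ∀ S → 0 < #avoid S
  #avoid-pos = All.wfRec count-wellFounded _ (λ S → 0 < #avoid S) step
    where
    step : ∀ S → (∀ {T} → count T < count S → 0 < #avoid T) → 0 < #avoid S
    step S IH with any S in S-inhabited
    ... | false = subst (0 <_) (sym #avoid-all) (m^n>0 2 n)
      where
      #avoid-all : #avoid S ≡ 2 ^ n
      #avoid-all = trans (∑Ω-cong (λ ω → cong (⟦_⟧ ∘ not) (any-none _ (λ b → cong (_∧ E b ω) (any-false S S-inhabited b)))))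
                         (trans (∑Ω-const {n} 1) (*-identityʳ (2 ^ n)))
    ... | true with any-elim S S-inhabited
    ...   | a , Sa = +-cancelʳ-< (#avoid S∖a) 0 (#avoid S) (begin-strict
      #avoid S∖a                           ≤⟨ ≤-trans (union-bound removed-is-a) (≤-reflexive (cong (#avoid S +_) (∑-select (#avoid∧ S∖a) a))) ⟩
      #avoid S + #avoid∧ S∖a a              <⟨ +-monoʳ-< (#avoid S) (*-cancelˡ-< (2 * M) _ _ hit<avoid) ⟩
      #avoid S + #avoid S∖a                ∎)
      where
      open ≤-Reasoning
      S∖a : Fin m → Bool
      S∖a b = S b ∧ not (b == a)
      removed-is-a : ∀ b → S b ≡ true → S∖a b ≡ false → b == a ≡ true
      removed-is-a b = ∧-not≡false⇒≡true
      hit<avoid : 2 * M * #avoid∧ S∖a a < 2 * M * #avoid S∖a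
      hit<avoid = ≤-<-trans (bound S∖a a)
        (*-monoˡ-< (#avoid S∖a) {{>-nonZero (IH (count-∧-< S _ a Sa (cong not (dec-true (a ≟ a) refl))))}} (weight<2M a))

  local-lemma : ∃ λ ω → ∀ a → E a ω ≡ false
  local-lemma with ∑Ω-pos⇒∃ _ (#avoid-pos (λ _ → true))
  ... | ω , avoids-all = ω , any-false (λ b → E b ω) (Bool.not-injective (⟦⟧-pos avoids-all))

-- Lonely vertices and friendly partitions

-- the colouring of N⁺[x] in which x, coloured b, has no out-neighbour of its colour
isolating : ∀ {n} → Bool → Fin n → Fin n → Bool
isolating b x y = if y == x then b else not b

isolating-involutive : ∀ {n} {b b′} (x y : Fin n) → b′ ≡ isolating b x y → b ≡ isolating b′ x y
isolating-involutive {b = b} x y with y == x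
... | true  = sym
... | false = λ b′≡not-b → trans (sym (Bool.not-involutive b)) (cong not (sym b′≡not-b))

module _ {n} (G : Digraph n) where

  closed : Fin n → Fin n → Bool
  closed x y = (y == x) ∨ arc G x y

  lonely : (Fin n → Bool) → Fin n → Bool
  lonely c x = not (any (λ y → arc G x y ∧ does (c y Bool.≟ c x)))

  separable-if-none-lonely : ∀ {u v} (c : Fin n → Bool) → c u ≡ true → c v ≡ false → (∀ x → lonely c x ≡ false) →
    Separable G u v
  separable-if-none-lonely c cu cv none-lonely =
    c , ((_ , cu) , (_ , cv) , friend) , λ cu≡cv → contradiction (trans (sym cu) (trans cu≡cv cv)) (λ ())
    where
    friend : ∀ x → ∃ λ y → arc G x y ≡ true × c y ≡ c x
    friend x with any-elim _ (Bool.not-injective (none-lonely x))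
    ... | y , arc∧same = y , Bool.∧-conicalˡ _ _ arc∧same , does-true (c y Bool.≟ c x) (Bool.∧-conicalʳ _ _ arc∧same)

  closed-self : ∀ x → closed x x ≡ true
  closed-self x = cong (_∨ arc G x x) (dec-true (x ≟ x) refl)

  closed-arc : ∀ {x y} → arc G x y ≡ true → closed x y ≡ true
  closed-arc {x} {y} xy = trans (cong ((y == x) ∨_) xy) (Bool.∨-zeroʳ (y == x))

  lonely-local : ∀ {c c′ x} → (∀ y → closed x y ≡ true → c y ≡ c′ y) → lonely c x ≡ lonely c′ x
  lonely-local {c} {c′} {x} agree = cong not (any-cong same)
    where
    same : ∀ y → (arc G x y ∧ does (c y Bool.≟ c x)) ≡ (arc G x y ∧ does (c′ y Bool.≟ c′ x))
    same y with arc G x y in xy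
    ... | false = refl
    ... | true  = cong₂ (λ a b → does (a Bool.≟ b)) (agree y (closed-arc xy)) (agree x (closed-self x))

  lonely-isolating : ∀ {c x y} → lonely c x ≡ true → closed x y ≡ true → c y ≡ isolating (c x) x y
  lonely-isolating {c} {x} {y} x-lonely xy with y ≟ x
  ... | yes refl = refl
  ... | no  _    = Bool.¬-not (does-false (c y Bool.≟ c x)
                     (∧≡false⇒ʳ≡false (any-false _ (Bool.not-injective x-lonely) y) xy))

  ⟦closed⟧ : ∀ x y → ⟦ closed x y ⟧ ≡ ⟦ y == x ⟧ + ⟦ arc G x y ⟧
  ⟦closed⟧ x y with y ≟ x
  ... | yes refl rewrite noLoop G x = refl
  ... | no  _    = refl

  count-closed : ∀ {k} → Regular G k → ∀ x → count (closed x) ≡ suc k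
  count-closed {k} regular x = begin
    count (closed x)                                  ≡⟨ sum-cong-≗ (⟦closed⟧ x) ⟩
    ∑[ y < n ] (⟦ y == x ⟧ + ⟦ arc G x y ⟧)           ≡⟨ ∑-distrib-+ (λ y → ⟦ y == x ⟧) (λ y → ⟦ arc G x y ⟧) ⟩
    count (_== x) + count (arc G x)                   ≡⟨ cong₂ _+_ (count-≟ x) (sym (countFin≡count n (arc G x))) ⟩
    1 + outDeg G x                                    ≡⟨ cong suc (proj₁ (regular x)) ⟩
    suc k                                             ∎
    where open ≡-Reasoning

  count-closed-column : ∀ {k} → Regular G k → ∀ y → count (λ x → closed x y) ≤ suc k
  count-closed-column {k} regular y = begin
    count (λ x → closed x y)                          ≡⟨ sum-cong-≗ (λ x → ⟦closed⟧ x y) ⟩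
    ∑[ x < n ] (⟦ y == x ⟧ + ⟦ arc G x y ⟧)           ≡⟨ ∑-distrib-+ (λ x → ⟦ y == x ⟧) (λ x → ⟦ arc G x y ⟧) ⟩
    count (y ==_) + count (λ x → arc G x y)           ≡⟨ cong₂ _+_ count-y== (sym (countFin≡count n (λ x → arc G x y))) ⟩
    1 + inDeg G y                                     ≡⟨ cong suc (proj₂ (regular y)) ⟩
    suc k                                             ∎
    where
    open ≤-Reasoning
    count-y== : count (y ==_) ≡ 1
    count-y== = trans (sum-cong-≗ (λ x → cong ⟦_⟧ (does-⇔ (mk⇔ sym sym) (y ≟ x) (x ≟ y)))) (count-≟ y)

-- Separating two vertices of a k-regular digraph

4[k+1][k+2]≤2^k : ∀ {k} → 9 ≤ k → 4 * (suc k * suc k + suc k) ≤ 2 ^ k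
4[k+1][k+2]≤2^k {k} 9≤k = subst (λ k → 4 * (suc k * suc k + suc k) ≤ 2 ^ k) (m+[n∸m]≡n 9≤k) (from-9 (k ∸ 9))
  where
  from-9 : ∀ j → 4 * (suc (9 + j) * suc (9 + j) + suc (9 + j)) ≤ 2 ^ (9 + j)
  from-9 zero    = ≤ᵇ⇒≤ 440 512 _
  from-9 (suc j) = ≤-trans (m≤m+n _ (4 * ((11 + j) * (8 + j)))) (≤-trans (≤-reflexive (step j)) (*-monoʳ-≤ 2 (from-9 j)))
    where
    step : ∀ j → 4 * (suc (10 + j) * suc (10 + j) + suc (10 + j)) + 4 * ((11 + j) * (8 + j))
               ≡ 2 * (4 * (suc (9 + j) * suc (9 + j) + suc (9 + j)))
    step = solve-∀

module Separation {n k : ℕ} (G : Digraph n) (regular : Regular G k) (u v : Fin n) (u≢v : u ≢ v) where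

  fixed : Fin n → Bool
  fixed y = (y == u) ∨ (y == v)

  colouring : Assignment n → Fin n → Bool
  colouring ω y = if y == u then true else if y == v then false else ω y

  vars : Fin n → Fin n → Bool
  vars x y = closed G x y ∧ not (fixed y)

  E : Fin n → Assignment n → Bool
  E x ω = lonely G (colouring ω) x

  colouring-u : ∀ ω → colouring ω u ≡ true
  colouring-u ω rewrite dec-true (u ≟ u) refl = refl

  colouring-v : ∀ ω → colouring ω v ≡ false
  colouring-v ω rewrite dec-false (v ≟ u) (u≢v ∘ sym) | dec-true (v ≟ v) refl = refl

  colouring-free : ∀ ω y → fixed y ≡ false → colouring ω y ≡ ω y
  colouring-free ω y y-free with y == u | y == v
  ... | false | false = refl

  colouring-fixed : ∀ ω ω′ y → fixed y ≡ true → colouring ω y ≡ colouring ω′ y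
  colouring-fixed ω ω′ y y-fixed with y == u | y == v
  ... | true  | _    = refl
  ... | false | true = refl

  E-dependsOn-vars : ∀ x → DependsOn (vars x) (E x)
  E-dependsOn-vars x ω ω′ agree = lonely-local G same-on-closed
    where
    same-on-closed : ∀ y → closed G x y ≡ true → colouring ω y ≡ colouring ω′ y
    same-on-closed y xy with fixed y in y-fixed
    ... | true  = colouring-fixed ω ω′ y y-fixed
    ... | false = trans (colouring-free ω y y-fixed)
                 (trans (agree y (cong₂ _∧_ xy (cong not y-fixed))) (sym (colouring-free ω′ y y-fixed)))

  fixed-u : fixed u ≡ true
  fixed-u = cong (_∨ (u == v)) (dec-true (u ≟ u) refl)

  fixed-v : fixed v ≡ true
  fixed-v = trans (cong ((v == u) ∨_) (dec-true (v ≟ v) refl)) (Bool.∨-zeroʳ (v == u))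

  E⇒agreesOn : ∀ x ω → E x ω ≡ true → agreesOn (vars x) (isolating (colouring ω x) x) ω ≡ true
  E⇒agreesOn x ω x-lonely = agreesOn-intro λ y xy-free →
    trans (sym (colouring-free ω y (Bool.not-injective (Bool.∧-conicalʳ _ _ xy-free))))
          (lonely-isolating G {colouring ω} {x} {y} x-lonely (Bool.∧-conicalˡ _ _ xy-free))

  -- A fixed vertex in N⁺[x] pins down the colour a lonely x must have.
  E⇒colour : ∀ x z → fixed z ≡ true → closed G x z ≡ true → ∀ ω → E x ω ≡ true →
    colouring ω x ≡ isolating (colouring (λ _ → false) z) x z
  E⇒colour x z z-fixed xz ω x-lonely =
    trans (isolating-involutive x z (lonely-isolating G {colouring ω} x-lonely xz))
          (cong (λ b → isolating b x z) (colouring-fixed ω _ z z-fixed))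

  forced : Fin n → Bool
  forced x = closed G x u ∨ closed G x v

  #E-bound-forced : ∀ x z → fixed z ≡ true → closed G x z ≡ true → # E x * 2 ^ count (vars x) * 2 ≤ 2 * 2 ^ n
  #E-bound-forced x z z-fixed xz =
    ≤-trans (≤-reflexive (*-comm (# E x * 2 ^ count (vars x)) 2)) (*-monoʳ-≤ 2 (#≤-agreeing (vars x) _ λ ω x-lonely →
      subst (λ b → agreesOn (vars x) (isolating b x) ω ≡ true) (E⇒colour x z z-fixed xz ω x-lonely) (E⇒agreesOn x ω x-lonely)))

  #E-bound : ∀ x → # E x * 2 ^ count (vars x) * 2 ^ ⟦ forced x ⟧ ≤ 2 * 2 ^ n
  #E-bound x with closed G x u in xu | closed G x v in xv
  ... | true  | _     = #E-bound-forced x u fixed-u xu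
  ... | false | true  = #E-bound-forced x v fixed-v xv
  ... | false | false = begin
    # E x * 2 ^ count (vars x) * 1
      ≡⟨ *-identityʳ _ ⟩
    # E x * 2 ^ count (vars x)
      ≤⟨ *-monoˡ-≤ _ (∑Ω-mono-≤ (λ ω → ≤-trans (⟦⟧-mono (E⇒agreesOn x ω)) (either (λ b → ⟦ A b ω ⟧) (colouring ω x)))) ⟩
    ∑Ω (λ ω → ⟦ A true ω ⟧ + ⟦ A false ω ⟧) * 2 ^ count (vars x)
      ≡⟨ cong (_* 2 ^ count (vars x)) (∑Ω-distrib-+ (λ ω → ⟦ A true ω ⟧) (λ ω → ⟦ A false ω ⟧)) ⟩
    (# A true + # A false) * 2 ^ count (vars x)
      ≡⟨ *-distribʳ-+ _ (# A true) (# A false) ⟩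
    # A true * 2 ^ count (vars x) + # A false * 2 ^ count (vars x)
      ≡⟨ cong₂ _+_ (#agreesOn (vars x) _) (trans (#agreesOn (vars x) _) (sym (+-identityʳ _))) ⟩
    2 * 2 ^ n ∎
    where
    open ≤-Reasoning
    A : Bool → Assignment n → Bool
    A b = agreesOn (vars x) (isolating b x)
    either : ∀ (f : Bool → ℕ) b → f b ≤ f true + f false
    either f true  = m≤m+n (f true) (f false)
    either f false = m≤n+m (f false) (f true)

  both : Fin n → Bool
  both x = closed G x u ∧ closed G x v

  -- w x = 2 exactly when N⁺[x] contains both fixed vertices; then only k − 1 of its vertices are free.
  w : Fin n → ℕ
  w x = 2 ^ ⟦ both x ⟧

  M : ℕ
  M = suc k * suc k + suc k

  suc-k≤exponent : ∀ x → suc k ≤ count (vars x) + ⟦ both x ⟧ + ⟦ forced x ⟧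
  suc-k≤exponent x = begin
    suc k                   ≡⟨ count-closed G regular x ⟨
    count (closed G x)      ≤⟨ sum-mono-≤ (λ y → split (closed G x y) (y == u) (y == v)) ⟩
    ∑[ y < n ] (⟦ vars x y ⟧ + ⟦ (y == u) ∧ closed G x y ⟧ + ⟦ (y == v) ∧ closed G x y ⟧)
      ≡⟨ trans (∑-distrib-+ (λ y → ⟦ vars x y ⟧ + ⟦ (y == u) ∧ closed G x y ⟧) (λ y → ⟦ (y == v) ∧ closed G x y ⟧))
               (cong (_+ count (λ y → (y == v) ∧ closed G x y))
                     (∑-distrib-+ (λ y → ⟦ vars x y ⟧) (λ y → ⟦ (y == u) ∧ closed G x y ⟧))) ⟩
    count (vars x) + count (λ y → (y == u) ∧ closed G x y) + count (λ y → (y == v) ∧ closed G x y)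
      ≡⟨ cong₂ (λ s t → count (vars x) + s + t) (count-≟-∧ u (closed G x)) (count-≟-∧ v (closed G x)) ⟩
    count (vars x) + ⟦ closed G x u ⟧ + ⟦ closed G x v ⟧
      ≡⟨ +-assoc (count (vars x)) _ _ ⟩
    count (vars x) + (⟦ closed G x u ⟧ + ⟦ closed G x v ⟧)
      ≡⟨ cong (count (vars x) +_) (⟦⟧-+ (closed G x u) (closed G x v)) ⟩
    count (vars x) + (⟦ both x ⟧ + ⟦ forced x ⟧)
      ≡⟨ +-assoc (count (vars x)) _ _ ⟨
    count (vars x) + ⟦ both x ⟧ + ⟦ forced x ⟧ ∎
    where
    open ≤-Reasoning
    split : ∀ c a b → ⟦ c ⟧ ≤ ⟦ c ∧ not (a ∨ b) ⟧ + ⟦ a ∧ c ⟧ + ⟦ b ∧ c ⟧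
    split false a     b     = z≤n
    split true  true  b     = m≤m+n 1 _
    split true  false true  = ≤-refl
    split true  false false = ≤-refl

  event-bound : 9 ≤ k → ∀ x → 4 * M * # E x ≤ w x * 2 ^ n
  event-bound 9≤k x = *-cancelʳ-≤ _ _ 2 (begin
    4 * M * # E x * 2                       ≤⟨ *-monoˡ-≤ 2 (*-monoˡ-≤ (# E x) (4[k+1][k+2]≤2^k 9≤k)) ⟩
    2 ^ k * # E x * 2                       ≡⟨ *-rotate (2 ^ k) (# E x) ⟩
    # E x * 2 ^ suc k                       ≤⟨ *-monoʳ-≤ (# E x) (^-monoʳ-≤ 2 (suc-k≤exponent x)) ⟩
    # E x * 2 ^ (f + b + c)                 ≡⟨ cong (# E x *_) (trans (^-distribˡ-+-* 2 (f + b) c) (cong (_* 2 ^ c) (^-distribˡ-+-* 2 f b))) ⟩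
    # E x * (2 ^ f * 2 ^ b * 2 ^ c)         ≡⟨ *-pull (# E x) (2 ^ f) (2 ^ b) (2 ^ c) ⟩
    2 ^ b * (# E x * 2 ^ f * 2 ^ c)         ≤⟨ *-monoʳ-≤ (2 ^ b) (#E-bound x) ⟩
    2 ^ b * (2 * 2 ^ n)                     ≡⟨ *-rotate′ (2 ^ b) (2 ^ n) ⟩
    w x * 2 ^ n * 2                         ∎)
    where
    open ≤-Reasoning
    f = count (vars x)
    b = ⟦ both x ⟧
    c = ⟦ forced x ⟧
    *-rotate : ∀ p e → p * e * 2 ≡ e * (2 * p)
    *-rotate = solve-∀
    *-pull : ∀ e p q r → e * (p * q * r) ≡ q * (e * p * r)
    *-pull = solve-∀
    *-rotate′ : ∀ q p → q * (2 * p) ≡ q * p * 2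
    *-rotate′ = solve-∀

  meets-count : ∀ a → ∑[ b < n ] ⟦ meets (vars a) (vars b) ⟧ ≤ suc k * suc k
  meets-count a = begin
    ∑[ b < n ] ⟦ meets (vars a) (vars b) ⟧
      ≤⟨ sum-mono-≤ (λ b → ⟦any⟧≤count (λ y → vars a y ∧ vars b y)) ⟩
    ∑[ b < n ] ∑[ y < n ] ⟦ vars a y ∧ vars b y ⟧
      ≤⟨ sum-mono-≤ (λ b → sum-mono-≤ (λ y →
           ≤-trans (⟦⟧-mono (both-closed b y)) (≤-reflexive (⟦∧⟧≡* (closed G a y) (closed G b y))))) ⟩
    ∑[ b < n ] ∑[ y < n ] (⟦ closed G a y ⟧ * ⟦ closed G b y ⟧)
      ≡⟨ ∑-comm (λ b y → ⟦ closed G a y ⟧ * ⟦ closed G b y ⟧) ⟩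
    ∑[ y < n ] ∑[ b < n ] (⟦ closed G a y ⟧ * ⟦ closed G b y ⟧)
      ≡⟨ sum-cong-≗ (λ y → *-distribˡ-sum ⟦ closed G a y ⟧ (λ b → ⟦ closed G b y ⟧)) ⟨
    ∑[ y < n ] (⟦ closed G a y ⟧ * count (λ b → closed G b y))
      ≤⟨ sum-mono-≤ (λ y → *-monoʳ-≤ ⟦ closed G a y ⟧ (count-closed-column G regular y)) ⟩
    ∑[ y < n ] (⟦ closed G a y ⟧ * suc k)
      ≡⟨ *-distribʳ-sum (suc k) (λ y → ⟦ closed G a y ⟧) ⟨
    count (closed G a) * suc k
      ≡⟨ cong (_* suc k) (count-closed G regular a) ⟩
    suc k * suc k ∎
    where
    open ≤-Reasoning
    both-closed : ∀ b y → (vars a y ∧ vars b y) ≡ true → (closed G a y ∧ closed G b y) ≡ true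
    both-closed b y ab = cong₂ _∧_
      (Bool.∧-conicalˡ (closed G a y) (not (fixed y)) (Bool.∧-conicalˡ (vars a y) (vars b y) ab))
      (Bool.∧-conicalˡ (closed G b y) (not (fixed y)) (Bool.∧-conicalʳ (vars a y) (vars b y) ab))

  neighbourhood-weight : ∀ a → ∑[ b < n ] (⟦ meets (vars a) (vars b) ⟧ * w b) ≤ M
  neighbourhood-weight a = begin
    ∑[ b < n ] (⟦ meets (vars a) (vars b) ⟧ * w b)
      ≤⟨ sum-mono-≤ (λ b → weight≤ (meets (vars a) (vars b)) (both b)) ⟩
    ∑[ b < n ] (⟦ meets (vars a) (vars b) ⟧ + ⟦ both b ⟧)
      ≡⟨ ∑-distrib-+ (λ b → ⟦ meets (vars a) (vars b) ⟧) (λ b → ⟦ both b ⟧) ⟩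
    ∑[ b < n ] ⟦ meets (vars a) (vars b) ⟧ + count both
      ≤⟨ +-mono-≤ (meets-count a) (≤-trans (sum-mono-≤ {g = λ b → ⟦ closed G b u ⟧} (λ b → ⟦⟧-mono (Bool.∧-conicalˡ _ _)))
                                            (count-closed-column G regular u)) ⟩
    M ∎
    where
    open ≤-Reasoning
    weight≤ : ∀ d e → ⟦ d ⟧ * 2 ^ ⟦ e ⟧ ≤ ⟦ d ⟧ + ⟦ e ⟧
    weight≤ false e     = z≤n
    weight≤ true  false = ≤-refl
    weight≤ true  true  = ≤-refl

  weight<2M : ∀ x → w x < 2 * M
  weight<2M x = <-≤-trans (w<4 (both x)) (*-monoʳ-≤ 2 (+-mono-≤ (s≤s z≤n) (s≤s z≤n)))
    where
    w<4 : ∀ e → 2 ^ ⟦ e ⟧ < 4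
    w<4 false = s≤s (s≤s z≤n)
    w<4 true  = s≤s (s≤s (s≤s z≤n))

corollary1p12 : (n k : ℕ) → 9 ≤ k → (G : Digraph n) → Regular G k →
    (u v : Fin n) → u ≢ v → Separable G u v
corollary1p12 n k 9≤k G regular u v u≢v =
  let ω , nobody-lonely = local-lemma
  in  separable-if-none-lonely G (colouring ω) (colouring-u ω) (colouring-v ω) nobody-lonely
  where
  open Separation G regular u v u≢v
  open LocalLemma E vars E-dependsOn-vars w M neighbourhood-weight (event-bound 9≤k) weight<2M
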